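{- Let $k\ge 1$ be an integer, $n=k^2$, and let $m=lk$ for some integer $l$ with $0\le l<k$. Then every $m\times n$ Sudoku rectangle can be extended to a Sudoku square of order $n$.
   Context: For $n=k^2$, an $n\times n$ matrix is divided into $k^2$ blocks: for $i,j\in[k]$ the $(i,j)$th block consists of the cells $((i-1)k+x,(j-1)k+y)$, $x,y\in[k]$. A partial Sudoku square of order $n$ is an $n\times n$ matrix with entries in $\{1,\dots,n\}\cup\{*\}$ ($*$ meaning an empty cell) such that each number of $\{1,\dots,n\}$ appears at most once in each row, at most once in each column, and at most once in each block. A Sudoku square is a partial Sudoku square with no empty cell. A partial Sudoku square $P_2$ extends $P_1$ (same order) if every nonempty cell of $P_1$ has the same entry in $P_2$. For $m<n$, an $m\times n$ Sudoku rectangle is a partial Sudoku square of order $n$ in which all cells of the first $m$ rows are filled and all other cells are empty. -}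

module Defs where

open import Data.Nat using (ℕ; suc; _*_; _<_; _≥_; NonZero)
open import Data.Nat.DivMod using (_/_)
open import Data.Fin using (Fin; toℕ)
open import Data.Maybe using (Maybe; just; nothing)
open import Data.Product using (_×_; ∃)
open import Relation.Binary.PropositionalEquality using (_≡_)

-- A (partial) matrix of order n = k²: entry 'nothing' is the empty cell '*',
-- 'just v' is the symbol v ∈ Fin n (standing for v+1 ∈ {1,…,n}).
Matrix : ℕ → Set
Matrix k = Fin (k * k) → Fin (k * k) → Maybe (Fin (k * k))

blk : (k : ℕ) → .{{_ : NonZero k}} → Fin (k * k) → ℕ
blk k i = toℕ i / k

SameBlock : (k : ℕ) → .{{_ : NonZero k}} → (r c r' c' : Fin (k * k)) → Set
SameBlock k r c r' c' = (blk k r ≡ blk k r') × (blk k c ≡ blk k c')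

IsPartialSudoku : (k : ℕ) → .{{_ : NonZero k}} → Matrix k → Set
IsPartialSudoku k P =
  (∀ r c c' v → P r c ≡ just v → P r c' ≡ just v → c ≡ c') ×
  (∀ r r' c v → P r c ≡ just v → P r' c ≡ just v → r ≡ r') ×
  (∀ r c r' c' v → SameBlock k r c r' c' →
     P r c ≡ just v → P r' c' ≡ just v → (r ≡ r') × (c ≡ c'))

IsComplete : (k : ℕ) → Matrix k → Set
IsComplete k P = ∀ r c → ∃ λ v → P r c ≡ just v

IsSudokuSquare : (k : ℕ) → .{{_ : NonZero k}} → Matrix k → Set
IsSudokuSquare k P = IsPartialSudoku k P × IsComplete k P

Extends : (k : ℕ) → Matrix k → Matrix k → Set
Extends k P₂ P₁ = ∀ r c v → P₁ r c ≡ just v → P₂ r c ≡ just v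

IsSudokuRectangle : (k : ℕ) → .{{_ : NonZero k}} → ℕ → Matrix k → Set
IsSudokuRectangle k m P =
  IsPartialSudoku k P ×
  (∀ r c → toℕ r < m → ∃ λ v → P r c ≡ just v) ×
  (∀ r c → toℕ r ≥ m → P r c ≡ nothing)

module Submission where

-- Write K = k + 1, so that n = K², and fill the bands of K rows one at a time. When l < K bands are
-- complete, each column misses (K - l)K symbols and each symbol misses at least K - l columns of
-- every stack. Matching symbols to K copies of the columns of a stack (Hall's theorem) therefore
-- assigns every symbol to one column of each stack that misses it, every column receiving exactly
-- K symbols. In the resulting bipartite graph of columns and symbols all degrees equal K, so it
-- splits into K disjoint perfect matchings (König), which are the rows of the next band: rows and
-- columns are Latin by construction, and blocks are because a symbol goes to one column per stack.

open import Data.Bool.Base using (Bool; true; false; T; not; _∧_; _∨_; if_then_else_)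
open import Data.Fin.Base
  using (Fin; zero; suc; toℕ; fromℕ<; inject≤; punchOut; combine; quotient; remainder; _↑ˡ_; _↑ʳ_)
open import Data.Fin.Properties using (_≟_; any?; all?; pigeonhole; punchOut-injective)
import Data.Fin.Properties as Finₚ
open import Data.Fin.Subset.Properties using (anySubset?)
open import Data.Maybe.Base using (just; nothing)
import Data.Maybe.Properties as Maybeₚ
open import Data.Nat.Base using (ℕ; zero; suc; NonZero; _+_; _*_; _∸_; _≤_; _<_; z≤n; s≤s; s≤s⁻¹; z<s)
open import Data.Nat.DivMod using (_/_; +-distrib-/-∣ˡ; m*n/n≡m; m<n⇒m/n≡0; m<n*o⇒m/o<n; /-monoˡ-≤)
open import Data.Nat.Divisibility using (m∣m*n)
open import Data.Nat.Properties hiding (_≟_)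
import Data.Nat.Properties as ℕₚ
open import Algebra.Properties.Semiring.Sum +-*-semiring
  using (sum-syntax; sum-cong-≗; ∑-distrib-+; ∑-comm; *-distribˡ-sum)
open import Data.Product.Base using (Σ; ∃; _×_; _,_; proj₁; proj₂)
open import Data.Sum.Base using (_⊎_; inj₁; inj₂)
open import Data.Unit.Base using (tt)
open import Data.Vec.Base using (lookup; tabulate)
open import Data.Vec.Properties using (lookup∘tabulate)
open import Function.Base using (_∘_; id)
open import Function.Definitions using (Injective)
open import Relation.Binary.PropositionalEquality
open import Relation.Nullary.Decidable
  using (Dec; yes; no; ⌊_⌋; map′; T?; toWitness; fromWitness; _×-dec_; _→-dec_)
open import Relation.Nullary.Negation using (¬_; contradiction)

open import Defs

private variable
  n a b : ℕ

∧⁺ : ∀ {x y} → T x → T y → T (x ∧ y)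
∧⁺ {true} _ y = y

∧⁻ˡ : ∀ x {y} → T (x ∧ y) → T x
∧⁻ˡ true _ = tt

∧⁻ʳ : ∀ x {y} → T (x ∧ y) → T y
∧⁻ʳ true y = y

∨⁺ˡ : ∀ {x} y → T x → T (x ∨ y)
∨⁺ˡ {true} _ _ = tt

∨⁺ʳ : ∀ x {y} → T y → T (x ∨ y)
∨⁺ʳ true _ = tt
∨⁺ʳ false y = y

∨⁻ : ∀ x {y} → T (x ∨ y) → T x ⊎ T y
∨⁻ true _ = inj₁ tt
∨⁻ false y = inj₂ y

not⁺ : ∀ {x} → ¬ T x → T (not x)
not⁺ {true} ¬x = ¬x tt
not⁺ {false} _ = tt

not⁻ : ∀ {x} → T (not x) → ¬ T x
not⁻ {false} _ ()

infixr 7 _∩_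
infixr 6 _∪_ _∖_
infix 4 _⊆_

_∩_ _∪_ _∖_ : (p q : Fin n → Bool) → Fin n → Bool
(p ∩ q) i = p i ∧ q i
(p ∪ q) i = p i ∨ q i
(p ∖ q) i = p i ∧ not (q i)

∁ : (Fin n → Bool) → Fin n → Bool
∁ p i = not (p i)

⁅_⁆ : Fin n → Fin n → Bool
⁅ j ⁆ i = ⌊ i ≟ j ⌋

_⊆_ : (p q : Fin n → Bool) → Set
p ⊆ q = ∀ i → T (p i) → T (q i)

⁅⁆⊆ : {p : Fin n → Bool} {j : Fin n} → T (p j) → ⁅ j ⁆ ⊆ p
⁅⁆⊆ {p = p} pj i i≡j = subst (T ∘ p) (sym (toWitness i≡j)) pj

∃ᵇ : (Fin n → Bool) → Bool
∃ᵇ p = ⌊ any? (T? ∘ p) ⌋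

∃ᵇ⁺ : ∀ {p : Fin n → Bool} i → T (p i) → T (∃ᵇ p)
∃ᵇ⁺ {p = p} i pi = fromWitness {a? = any? (T? ∘ p)} (i , pi)

∃ᵇ⁻ : ∀ {p : Fin n → Bool} → T (∃ᵇ p) → ∃ λ i → T (p i)
∃ᵇ⁻ {p = p} = toWitness {a? = any? (T? ∘ p)}

⌊suc≟suc⌋ : (i j : Fin n) → ⌊ suc i ≟ suc j ⌋ ≡ ⌊ i ≟ j ⌋
⌊suc≟suc⌋ i j with i ≟ j
... | yes _ = refl
... | no _ = refl

∑-mono-≤ : {f g : Fin n → ℕ} → (∀ i → f i ≤ g i) → ∑[ i < n ] f i ≤ ∑[ i < n ] g i
∑-mono-≤ {zero} _ = z≤n
∑-mono-≤ {suc n} f≤g = +-mono-≤ (f≤g zero) (∑-mono-≤ (f≤g ∘ suc))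

∑-const : (x : ℕ) → ∑[ i < n ] x ≡ n * x
∑-const {zero} x = refl
∑-const {suc n} x = cong (x +_) (∑-const {n} x)

∑-↑ : ∀ {m p} (h : Fin (m + p) → ℕ) → ∑[ i < m + p ] h i ≡ ∑[ i < m ] h (i ↑ˡ p) + ∑[ j < p ] h (m ↑ʳ j)
∑-↑ {zero} h = refl
∑-↑ {suc m} h = trans (cong (h zero +_) (∑-↑ {m} (h ∘ suc))) (sym (+-assoc (h zero) _ _))

∑-combine : ∀ {m n} (h : Fin (m * n) → ℕ) → ∑[ r < m * n ] h r ≡ ∑[ i < m ] ∑[ j < n ] h (combine i j)
∑-combine {zero} h = refl
∑-combine {suc m} {n} h =
  trans (∑-↑ {n} {m * n} h) (cong (∑[ j < n ] h (j ↑ˡ m * n) +_) (∑-combine {m} (h ∘ (n ↑ʳ_))))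

ind : Bool → ℕ
ind b = if b then 1 else 0

ind-T : ∀ {x} → T x → ind x ≡ 1
ind-T {true} _ = refl

ind-¬T : ∀ {x} → ¬ T x → ind x ≡ 0
ind-¬T {true} ¬x = contradiction tt ¬x
ind-¬T {false} _ = refl

count : (Fin n → Bool) → ℕ
count {n} p = ∑[ i < n ] ind (p i)

count-cong : {p q : Fin n → Bool} → (∀ i → p i ≡ q i) → count p ≡ count q
count-cong p≗q = sum-cong-≗ (cong ind ∘ p≗q)

count-mono : {p q : Fin n → Bool} → p ⊆ q → count p ≤ count q
count-mono p⊆q = ∑-mono-≤ (λ i → ind-mono (p⊆q i))
  where
  ind-mono : ∀ {x y} → (T x → T y) → ind x ≤ ind y
  ind-mono {true} {true} _ = ≤-refl
  ind-mono {true} {false} x⇒y = contradiction tt x⇒y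
  ind-mono {false} _ = z≤n

count-⊤ : count {n} (λ _ → true) ≡ n
count-⊤ {zero} = refl
count-⊤ {suc n} = cong suc (count-⊤ {n})

count-∅ : {p : Fin n → Bool} → (∀ i → ¬ T (p i)) → count p ≡ 0
count-∅ {n} ∉p = trans (sum-cong-≗ (ind-¬T ∘ ∉p)) (trans (∑-const {n} 0) (*-zeroʳ n))

count-split : (p q : Fin n → Bool) → count p ≡ count (p ∩ q) + count (p ∖ q)
count-split p q = trans (sum-cong-≗ (λ i → split (p i) (q i))) (∑-distrib-+ (ind ∘ (p ∩ q)) (ind ∘ (p ∖ q)))
  where
  split : ∀ x y → ind x ≡ ind (x ∧ y) + ind (x ∧ not y)
  split true true = refl
  split true false = refl
  split false _ = refl

count-∖ : {p q : Fin n → Bool} → q ⊆ p → count p ≡ count q + count (p ∖ q)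
count-∖ {p = p} {q} q⊆p = trans (sum-cong-≗ (λ i → split (q⊆p i))) (∑-distrib-+ (ind ∘ q) (ind ∘ (p ∖ q)))
  where
  split : ∀ {x y} → (T y → T x) → ind x ≡ ind y + ind (x ∧ not y)
  split {true} {true} _ = refl
  split {true} {false} _ = refl
  split {false} {true} y⇒x = contradiction tt y⇒x
  split {false} {false} _ = refl

count-∁ : (p : Fin n → Bool) → count (∁ p) ≡ n ∸ count p
count-∁ {n} p = begin
  count (∁ p)                         ≡⟨ m+n∸m≡n (count p) (count (∁ p)) ⟨
  count p + count (∁ p) ∸ count p     ≡⟨ cong (_∸ count p) (count-∖ {p = λ _ → true} {q = p} (λ _ _ → tt)) ⟨
  count {n} (λ _ → true) ∸ count p    ≡⟨ cong (_∸ count p) count-⊤ ⟩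
  n ∸ count p                         ∎
  where open ≡-Reasoning

count-∪ : (p q : Fin n → Bool) → count (p ∪ q) + count (p ∩ q) ≡ count p + count q
count-∪ p q = begin
  count (p ∪ q) + count (p ∩ q)          ≡⟨ ∑-distrib-+ (ind ∘ (p ∪ q)) (ind ∘ (p ∩ q)) ⟨
  ∑[ i < _ ] (ind (p i ∨ q i) + ind (p i ∧ q i)) ≡⟨ sum-cong-≗ (λ i → incl-excl (p i) (q i)) ⟩
  ∑[ i < _ ] (ind (p i) + ind (q i))     ≡⟨ ∑-distrib-+ (ind ∘ p) (ind ∘ q) ⟩
  count p + count q                      ∎
  where
  open ≡-Reasoning
  incl-excl : ∀ x y → ind (x ∨ y) + ind (x ∧ y) ≡ ind x + ind y
  incl-excl true true = refl
  incl-excl true false = refl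
  incl-excl false true = refl
  incl-excl false false = refl

count-∪-≤ : (p q : Fin n → Bool) → count (p ∪ q) ≤ count p + count q
count-∪-≤ p q = m+n≤o⇒m≤o (count (p ∪ q)) (≤-reflexive (count-∪ p q))

count-disjoint-∪ : (p q : Fin n → Bool) → (∀ i → T (p i) → ¬ T (q i)) →
                   count (p ∪ q) ≡ count p + count q
count-disjoint-∪ p q disj = begin
  count (p ∪ q)                 ≡⟨ +-identityʳ _ ⟨
  count (p ∪ q) + 0             ≡⟨ cong (count (p ∪ q) +_) (count-∅ p∩q-empty) ⟨
  count (p ∪ q) + count (p ∩ q) ≡⟨ count-∪ p q ⟩
  count p + count q             ∎
  where
  open ≡-Reasoning
  p∩q-empty : ∀ i → ¬ T (p i ∧ q i)
  p∩q-empty i pq = disj i (∧⁻ˡ (p i) pq) (∧⁻ʳ (p i) pq)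

count-⁅⁆ : (j : Fin n) → count ⁅ j ⁆ ≡ 1
count-⁅⁆ {suc n} zero = cong suc (count-∅ {n} (λ _ ()))
count-⁅⁆ {suc n} (suc j) = trans (count-cong (λ i → ⌊suc≟suc⌋ i j)) (count-⁅⁆ j)

count-remove : {p : Fin n → Bool} (j : Fin n) → T (p j) → count p ≡ suc (count (p ∖ ⁅ j ⁆))
count-remove {p = p} j pj = trans (count-∖ (⁅⁆⊆ {p = p} pj)) (cong (_+ count (p ∖ ⁅ j ⁆)) (count-⁅⁆ j))

count-∖-< : {p q : Fin n → Bool} → q ⊆ p → 0 < count q → count (p ∖ q) < count p
count-∖-< {p = p} {q} q⊆p pos = subst (count (p ∖ q) <_) (sym (count-∖ q⊆p)) (m<n+m (count (p ∖ q)) pos)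

nonempty⇒count>0 : {p : Fin n → Bool} (i : Fin n) → T (p i) → 0 < count p
nonempty⇒count>0 {p = p} i pi = subst (0 <_) (sym (count-remove {p = p} i pi)) (s≤s z≤n)

count>0⇒nonempty : (p : Fin n → Bool) → 0 < count p → ∃ λ i → T (p i)
count>0⇒nonempty {suc n} p 0<c with p zero in p₀
... | true = zero , subst T (sym p₀) tt
... | false = let i , pi = count>0⇒nonempty (p ∘ suc) 0<c in suc i , pi

count-quotient : ∀ {m} n (g : Fin m → Bool) → count (g ∘ quotient {m} n) ≡ n * count g
count-quotient {m} n g = begin
  count (g ∘ quotient n)                                   ≡⟨ ∑-combine {m} {n} (ind ∘ g ∘ quotient n) ⟩
  ∑[ i < m ] ∑[ j < n ] ind (g (quotient n (combine i j))) ≡⟨ sum-cong-≗ (λ i → sum-cong-≗ {n} (cong (ind ∘ g) ∘ quotient-combine i)) ⟩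
  ∑[ i < m ] ∑[ j < n ] ind (g i)                          ≡⟨ sum-cong-≗ (λ i → ∑-const {n} (ind (g i))) ⟩
  ∑[ i < m ] (n * ind (g i))                               ≡⟨ *-distribˡ-sum n (ind ∘ g) ⟨
  n * count g                                              ∎
  where
  open ≡-Reasoning
  quotient-combine : ∀ i j → quotient {m} n (combine i j) ≡ i
  quotient-combine i j = cong proj₁ (Finₚ.remQuot-combine i j)

count-injection : {p : Fin a → Bool} {q : Fin b → Bool} (f : ∀ i → T (p i) → Fin b) →
                  (∀ i pi → T (q (f i pi))) →
                  (∀ i i' pi pi' → f i pi ≡ f i' pi' → i ≡ i') →
                  count p ≤ count q
count-injection {zero} _ _ _ = z≤n
count-injection {suc a} {p = p} {q} f f∈q f-inj with T? (p zero)
... | no ¬p₀ = subst (_≤ count q) (cong (_+ count (p ∘ suc)) (sym (ind-¬T ¬p₀)))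
                 (count-injection (f ∘ suc) (f∈q ∘ suc)
                   λ i i' pi pi' → Finₚ.suc-injective ∘ f-inj (suc i) (suc i') pi pi')
... | yes p₀ = begin
  count p                 ≡⟨ cong (_+ count (p ∘ suc)) (ind-T p₀) ⟩
  suc (count (p ∘ suc))   ≤⟨ s≤s (count-injection (f ∘ suc) f∈q∖y
                               λ i i' pi pi' → Finₚ.suc-injective ∘ f-inj (suc i) (suc i') pi pi') ⟩
  suc (count (q ∖ ⁅ y ⁆)) ≡⟨ count-remove y (f∈q zero p₀) ⟨
  count q                 ∎
  where
  open ≤-Reasoning
  y = f zero p₀
  f∈q∖y : ∀ i pi → T ((q ∖ ⁅ y ⁆) (f (suc i) pi))
  f∈q∖y i pi = ∧⁺ (f∈q (suc i) pi)
                  (not⁺ (λ fi≡y → Finₚ.0≢1+n (f-inj zero (suc i) p₀ pi (sym (toWitness fi≡y)))))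

injective⇒surjective : (f : Fin n → Fin n) → Injective _≡_ _≡_ f → ∀ y → ∃ λ x → f x ≡ y
injective⇒surjective {suc n} f f-inj y with any? (λ x → f x ≟ y)
... | yes found = found
... | no ¬found =
  let i , j , i<j , gi≡gj = pigeonhole (n<1+n n) (λ x → punchOut (misses x))
  in contradiction (f-inj (punchOut-injective (misses i) (misses j) gi≡gj)) (Finₚ.<⇒≢ i<j)
  where
  misses : ∀ x → y ≢ f x
  misses x y≡fx = ¬found (x , sym y≡fx)

∃-subset? : {P : (Fin n → Bool) → Set} → (∀ X → Dec (P X)) →
            (∀ {X Y} → (∀ i → X i ≡ Y i) → P X → P Y) → Dec (∃ P)
∃-subset? P? resp = map′ (λ (v , Pv) → lookup v , Pv)
  (λ (X , PX) → tabulate X , resp (λ i → sym (lookup∘tabulate X i)) PX)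
  (anySubset? (P? ∘ lookup))

module _ (G : Fin a → Fin b → Bool) where

  nbhd : (Fin b → Bool) → (Fin a → Bool) → Fin b → Bool
  nbhd R X j = R j ∧ ∃ᵇ (λ i → X i ∧ G i j)

  HallCondition : (Fin a → Bool) → (Fin b → Bool) → Set
  HallCondition L R = ∀ X → X ⊆ L → count X ≤ count (nbhd R X)

  record Matching (L : Fin a → Bool) (R : Fin b → Bool) : Set where
    field
      partner   : ∀ i → T (L i) → Fin b
      partner∈R : ∀ i li → T (R (partner i li))
      edge      : ∀ i li → T (G i (partner i li))
      injective : ∀ i i' li li' → partner i li ≡ partner i' li' → i ≡ i'

  nbhd⁺ : ∀ R X {i j} → T (R j) → T (X i) → T (G i j) → T (nbhd R X j)
  nbhd⁺ R X {i} rj xi gij = ∧⁺ rj (∃ᵇ⁺ i (∧⁺ xi gij))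

  nbhd⁻ : ∀ R X {j} → T (nbhd R X j) → T (R j) × ∃ λ i → T (X i) × T (G i j)
  nbhd⁻ R X {j} n = let i , xg = ∃ᵇ⁻ (∧⁻ʳ (R j) n) in
    ∧⁻ˡ (R j) n , i , ∧⁻ˡ (X i) xg , ∧⁻ʳ (X i) xg

  nbhd-mono : ∀ {R R' X X'} → R ⊆ R' → X ⊆ X' → nbhd R X ⊆ nbhd R' X'
  nbhd-mono {R} {R'} {X} {X'} R⊆R' X⊆X' j n =
    let rj , i , xi , gij = nbhd⁻ R X n in nbhd⁺ R' X' (R⊆R' j rj) (X⊆X' i xi) gij

  emptyMatching : ∀ {L R} → (∀ i → ¬ T (L i)) → Matching L R
  emptyMatching L-empty = record
    { partner   = λ i li → contradiction li (L-empty i)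
    ; partner∈R = λ i li → contradiction li (L-empty i)
    ; edge      = λ i li → contradiction li (L-empty i)
    ; injective = λ i _ li _ _ → contradiction li (L-empty i)
    }

  singletonMatching : ∀ {i₀ j₀} → T (G i₀ j₀) → Matching ⁅ i₀ ⁆ ⁅ j₀ ⁆
  singletonMatching {i₀} {j₀} g = record
    { partner   = λ _ _ → j₀
    ; partner∈R = λ _ _ → fromWitness refl
    ; edge      = λ i i≡i₀ → subst (λ x → T (G x j₀)) (sym (toWitness i≡i₀)) g
    ; injective = λ _ _ i≡i₀ i'≡i₀ _ → trans (toWitness i≡i₀) (sym (toWitness i'≡i₀))
    }

  glue : ∀ {L R X R'} → R' ⊆ R → Matching X R' → Matching (L ∖ X) (R ∖ R') → Matching L R
  glue {L} {R} {X} {R'} R'⊆R M₁ M₂ = record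
    { partner = partner ; partner∈R = partner∈R ; edge = edge ; injective = injective }
    where
    module M₁ = Matching M₁
    module M₂ = Matching M₂
    outside : ∀ {i} → T (L i) → ¬ T (X i) → T ((L ∖ X) i)
    outside li ¬xi = ∧⁺ li (not⁺ ¬xi)
    apart : ∀ i i' xi li' ¬xi' → M₁.partner i xi ≢ M₂.partner i' (outside li' ¬xi')
    apart i i' xi li' ¬xi' eq = not⁻ (∧⁻ʳ (R _) (M₂.partner∈R i' _)) (subst (T ∘ R') eq (M₁.partner∈R i xi))
    partner : ∀ i → T (L i) → Fin b
    partner i li with T? (X i)
    ... | yes xi = M₁.partner i xi
    ... | no ¬xi = M₂.partner i (outside li ¬xi)
    partner∈R : ∀ i li → T (R (partner i li))
    partner∈R i li with T? (X i)
    ... | yes xi = R'⊆R _ (M₁.partner∈R i xi)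
    ... | no ¬xi = ∧⁻ˡ (R _) (M₂.partner∈R i _)
    edge : ∀ i li → T (G i (partner i li))
    edge i li with T? (X i)
    ... | yes xi = M₁.edge i xi
    ... | no ¬xi = M₂.edge i _
    injective : ∀ i i' li li' → partner i li ≡ partner i' li' → i ≡ i'
    injective i i' li li' eq with T? (X i) | T? (X i')
    ... | yes xi | yes xi' = M₁.injective i i' xi xi' eq
    ... | no _   | no _    = M₂.injective i i' _ _ eq
    ... | yes xi | no ¬xi' = contradiction eq (apart i i' xi li' ¬xi')
    ... | no ¬xi | yes xi' = contradiction (sym eq) (apart i' i xi' li ¬xi)

  hall-restrict : ∀ {L R X} → HallCondition L R → X ⊆ L → HallCondition X (nbhd R X)
  hall-restrict {L} {R} {X} hall X⊆L Y Y⊆X =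
    ≤-trans (hall Y (λ i → X⊆L i ∘ Y⊆X i)) (count-mono nbhdY⊆)
    where
    nbhdY⊆ : nbhd R Y ⊆ nbhd (nbhd R X) Y
    nbhdY⊆ j n = let rj , i , yi , gij = nbhd⁻ R Y n in
      nbhd⁺ (nbhd R X) Y (nbhd⁺ R X rj (Y⊆X i yi) gij) yi gij

  -- For Y ⊆ L ∖ X, apply Hall's condition to Y ∪ X and subtract the tight set X.
  hall-contract : ∀ {L R X} → HallCondition L R → X ⊆ L → count (nbhd R X) ≤ count X →
                  HallCondition (L ∖ X) (R ∖ nbhd R X)
  hall-contract {L} {R} {X} hall X⊆L tight Y Y⊆L∖X = +-cancelˡ-≤ (count X) _ _ (begin
    count X + count Y                      ≡⟨ +-comm (count X) (count Y) ⟩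
    count Y + count X                      ≡⟨ count-disjoint-∪ Y X Y∩X-empty ⟨
    count (Y ∪ X)                          ≤⟨ hall (Y ∪ X) Y∪X⊆L ⟩
    count (nbhd R (Y ∪ X))                 ≤⟨ count-mono nbhd-split ⟩
    count (nbhd R X ∪ nbhd R' Y)           ≤⟨ count-∪-≤ (nbhd R X) (nbhd R' Y) ⟩
    count (nbhd R X) + count (nbhd R' Y)   ≤⟨ +-monoˡ-≤ (count (nbhd R' Y)) tight ⟩
    count X + count (nbhd R' Y)            ∎)
    where
    open ≤-Reasoning
    R' = R ∖ nbhd R X
    Y∩X-empty : ∀ i → T (Y i) → ¬ T (X i)
    Y∩X-empty i yi = not⁻ (∧⁻ʳ (L i) (Y⊆L∖X i yi))
    Y∪X⊆L : (Y ∪ X) ⊆ L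
    Y∪X⊆L i yx with ∨⁻ (Y i) yx
    ... | inj₁ yi = ∧⁻ˡ (L i) (Y⊆L∖X i yi)
    ... | inj₂ xi = X⊆L i xi
    nbhd-split : nbhd R (Y ∪ X) ⊆ (nbhd R X ∪ nbhd R' Y)
    nbhd-split j n with T? (nbhd R X j)
    ... | yes nXj = ∨⁺ˡ (nbhd R' Y j) nXj
    ... | no ¬nXj = let rj , i , yxi , gij = nbhd⁻ R (Y ∪ X) n in
      ∨⁺ʳ (nbhd R X j) (nbhd⁺ R' Y (∧⁺ rj (not⁺ ¬nXj)) (in-Y i rj yxi gij) gij)
      where
      in-Y : ∀ i → T (R j) → T ((Y ∪ X) i) → T (G i j) → T (Y i)
      in-Y i rj yxi gij with ∨⁻ (Y i) yxi
      ... | inj₁ yi = yi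
      ... | inj₂ xi = contradiction (nbhd⁺ R X rj xi gij) ¬nXj

  Critical : (Fin a → Bool) → (Fin b → Bool) → (Fin a → Bool) → Set
  Critical L R X = X ⊆ L × 0 < count X × count X < count L × count (nbhd R X) ≤ count X

  critical? : ∀ L R X → Dec (Critical L R X)
  critical? L R X = all? (λ i → T? (X i) →-dec T? (L i))
    ×-dec 0 <? count X ×-dec count X <? count L ×-dec count (nbhd R X) ≤? count X

  critical-resp : ∀ {L R X Y} → (∀ i → X i ≡ Y i) → Critical L R X → Critical L R Y
  critical-resp {L} {R} {X} {Y} X≗Y (X⊆L , pos , X<L , tight) =
    (λ i → X⊆L i ∘ Y⊆X i) , subst (0 <_) cX≡cY pos , subst (_< count L) cX≡cY X<L ,
    ≤-trans (count-mono (nbhd-mono {R} (λ _ → id) Y⊆X)) (subst (_ ≤_) cX≡cY tight)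
    where
    Y⊆X : Y ⊆ X
    Y⊆X i = subst T (sym (X≗Y i))
    cX≡cY : count X ≡ count Y
    cX≡cY = count-cong X≗Y

  -- Without critical sets, every nonempty proper Y ⊆ L has a surplus neighbour,
  -- so any single edge may be removed.
  hall-surplus : ∀ {L R i₀ j₀} → HallCondition L R → (∀ X → ¬ Critical L R X) → T (L i₀) →
                 HallCondition (L ∖ ⁅ i₀ ⁆) (R ∖ ⁅ j₀ ⁆)
  hall-surplus {L} {R} {i₀} {j₀} hall noCritical li₀ Y Y⊆L' with 0 <? count Y
  ... | no ¬pos = ≤-trans (≮⇒≥ ¬pos) z≤n
  ... | yes pos = s≤s⁻¹ (begin
    suc (count Y)                  ≤⟨ ≰⇒> (λ tight → noCritical Y (Y⊆L , pos , Y<L , tight)) ⟩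
    count (nbhd R Y)               ≤⟨ count-mono nbhd-split ⟩
    count (⁅ j₀ ⁆ ∪ nbhd R' Y)     ≤⟨ count-∪-≤ ⁅ j₀ ⁆ (nbhd R' Y) ⟩
    count ⁅ j₀ ⁆ + count (nbhd R' Y) ≡⟨ cong (_+ count (nbhd R' Y)) (count-⁅⁆ j₀) ⟩
    suc (count (nbhd R' Y))        ∎)
    where
    open ≤-Reasoning
    R' = R ∖ ⁅ j₀ ⁆
    Y⊆L : Y ⊆ L
    Y⊆L i yi = ∧⁻ˡ (L i) (Y⊆L' i yi)
    Y<L : count Y < count L
    Y<L = subst (count Y <_) (sym (count-remove i₀ li₀)) (s≤s (count-mono Y⊆L'))
    nbhd-split : nbhd R Y ⊆ (⁅ j₀ ⁆ ∪ nbhd R' Y)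
    nbhd-split j n with T? (⁅ j₀ ⁆ j)
    ... | yes j≡j₀ = ∨⁺ˡ (nbhd R' Y j) j≡j₀
    ... | no j≢j₀ = let rj , i , yi , gij = nbhd⁻ R Y n in
      ∨⁺ʳ (⁅ j₀ ⁆ j) (nbhd⁺ R' Y (∧⁺ rj (not⁺ j≢j₀)) yi gij)

  hall : ∀ c {L R} → count L ≤ c → HallCondition L R → Matching L R
  hall zero cL≤0 _ = emptyMatching (λ i li → contradiction (≤-trans (nonempty⇒count>0 i li) cL≤0) λ ())
  hall (suc c) {L} {R} cL≤ hallLR with ∃-subset? (critical? L R) critical-resp
  ... | yes (X , X⊆L , pos , X<L , tight) =
    glue (λ j → ∧⁻ˡ (R j))
      (hall c (s≤s⁻¹ (≤-trans X<L cL≤)) (hall-restrict hallLR X⊆L))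
      (hall c (s≤s⁻¹ (≤-trans (count-∖-< X⊆L pos) cL≤)) (hall-contract hallLR X⊆L tight))
  ... | no noCritical with 0 <? count L
  ...   | no ¬pos = emptyMatching (λ i li → ¬pos (nonempty⇒count>0 i li))
  ...   | yes pos =
    let i₀ , li₀ = count>0⇒nonempty L pos
        j₀ , nj₀ = count>0⇒nonempty (nbhd R ⁅ i₀ ⁆)
                     (≤-trans (nonempty⇒count>0 i₀ (fromWitness refl)) (hallLR ⁅ i₀ ⁆ (⁅⁆⊆ li₀)))
        rj₀ , i , i≡i₀ , gij₀ = nbhd⁻ R ⁅ i₀ ⁆ nj₀
    in glue (λ j j≡j₀ → subst (T ∘ R) (sym (toWitness j≡j₀)) rj₀)
         (singletonMatching (subst (λ x → T (G x j₀)) (toWitness i≡i₀) gij₀))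
         (hall c (s≤s⁻¹ (subst (_≤ suc c) (count-remove i₀ li₀) cL≤))
                 (hall-surplus hallLR (λ X crit → noCritical (X , crit)) li₀))

  degree-bounded-matching : ∀ D → 0 < D → (∀ i → D ≤ count (G i)) → (∀ j → count (λ i → G i j) ≤ D) →
                    Σ (Fin a → Fin b) λ f → (∀ i → T (G i (f i))) × Injective _≡_ _≡_ f
  degree-bounded-matching (suc D-1) _ degˡ degʳ =
    (λ i → M.partner i tt) , (λ i → M.edge i tt) , M.injective _ _ tt tt
    where
    D = suc D-1
    hall-⊤ : HallCondition (λ _ → true) (λ _ → true)
    hall-⊤ X _ = *-cancelˡ-≤ D (begin
      D * count X                             ≡⟨ *-distribˡ-sum D (ind ∘ X) ⟩
      ∑[ i < a ] (D * ind (X i))              ≤⟨ ∑-mono-≤ out-degree ⟩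
      ∑[ i < a ] ∑[ j < b ] ind (X i ∧ G i j) ≡⟨ ∑-comm (λ i j → ind (X i ∧ G i j)) ⟩
      ∑[ j < b ] ∑[ i < a ] ind (X i ∧ G i j) ≤⟨ ∑-mono-≤ in-degree ⟩
      ∑[ j < b ] (D * ind (N j))              ≡⟨ *-distribˡ-sum D (ind ∘ N) ⟨
      D * count N                             ∎)
      where
      open ≤-Reasoning
      N = nbhd (λ _ → true) X
      out-degree : ∀ i → D * ind (X i) ≤ ∑[ j < b ] ind (X i ∧ G i j)
      out-degree i with X i
      ... | true = subst (_≤ count (G i)) (sym (*-identityʳ D)) (degˡ i)
      ... | false = ≤-trans (≤-reflexive (*-zeroʳ D)) z≤n
      in-degree : ∀ j → ∑[ i < a ] ind (X i ∧ G i j) ≤ D * ind (N j)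
      in-degree j with T? (N j)
      ... | yes Nj = begin
        count (X ∩ λ i → G i j) ≤⟨ count-mono (λ i → ∧⁻ʳ (X i)) ⟩
        count (λ i → G i j)     ≤⟨ degʳ j ⟩
        D                       ≡⟨ *-identityʳ D ⟨
        D * 1                   ≡⟨ cong (D *_) (ind-T Nj) ⟨
        D * ind (N j)           ∎
      ... | no ¬Nj = ≤-reflexive (begin-equality
        count (X ∩ λ i → G i j) ≡⟨ count-∅ (λ i xg → ¬Nj (∃ᵇ⁺ i xg)) ⟩
        0                       ≡⟨ *-zeroʳ D ⟨
        D * 0                   ≡⟨ cong (D *_) (ind-¬T ¬Nj) ⟨
        D * ind (N j)           ∎)
    M = hall a (≤-reflexive count-⊤) hall-⊤
    module M = Matching M

record LatinRectangle (F : Fin n → Fin n → Bool) (t : ℕ) : Set where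
  field
    entry            : Fin t → Fin n → Fin n
    row-injective    : ∀ u → Injective _≡_ _≡_ (entry u)
    column-injective : ∀ c → Injective _≡_ _≡_ (λ u → entry u c)
    allowed          : ∀ u c → T (F c (entry u c))

module _ (F : Fin n → Fin n → Bool) (D : ℕ)
         (degˡ : ∀ c → D ≤ count (F c)) (degʳ : ∀ s → count (λ c → F c s) ≤ D) where

  module FreeEntries {t} (L : LatinRectangle F t) where

    open LatinRectangle L

    used : Fin n → Fin n → Bool
    used c s = ∃ᵇ (λ u → ⌊ entry u c ≟ s ⌋)

    free : Fin n → Fin n → Bool
    free c = F c ∖ used c

    used⁻ : ∀ {c s} → T (used c s) → ∃ λ u → entry u c ≡ s
    used⁻ us = let u , eq = ∃ᵇ⁻ us in u , toWitness eq

    used-column : ∀ c → count (used c) ≤ t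
    used-column c = subst (count (used c) ≤_) count-⊤
      (count-injection (λ _ us → proj₁ (used⁻ us)) (λ _ _ → tt)
        λ _ _ us us' u≡u' →
          trans (sym (proj₂ (used⁻ us))) (trans (cong (λ u → entry u c) u≡u') (proj₂ (used⁻ us'))))

    used-symbol : ∀ s → t ≤ count (λ c → F c s ∧ used c s)
    used-symbol s = subst (_≤ count (λ c → F c s ∧ used c s)) count-⊤
      (count-injection {p = λ _ → true} {q = λ c → F c s ∧ used c s} (λ u _ → position u) position-used
        (λ u u' _ _ eq → column-injective (position u')
          (trans (cong (entry u) (sym eq)) (trans (proj₂ (preimage u)) (sym (proj₂ (preimage u')))))))
      where
      preimage : ∀ u → ∃ λ c → entry u c ≡ s
      preimage u = injective⇒surjective (entry u) (row-injective u) s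
      position : Fin t → Fin n
      position u = proj₁ (preimage u)
      position-used : ∀ u _ → T (F (position u) s ∧ used (position u) s)
      position-used u _ = ∧⁺ (subst (T ∘ F (position u)) (proj₂ (preimage u)) (allowed u (position u)))
                             (∃ᵇ⁺ u (fromWitness (proj₂ (preimage u))))

    free-degˡ : ∀ c → D ∸ t ≤ count (free c)
    free-degˡ c = m≤n+o⇒m∸n≤o D t (begin
      D                                       ≤⟨ degˡ c ⟩
      count (F c)                             ≡⟨ count-split (F c) (used c) ⟩
      count (F c ∩ used c) + count (free c)   ≤⟨ +-monoˡ-≤ (count (free c)) used-bound ⟩
      t + count (free c)                      ∎)
      where
      open ≤-Reasoning
      used-bound = ≤-trans (count-mono (λ s → ∧⁻ʳ (F c s))) (used-column c)

    free-degʳ : ∀ s → count (λ c → free c s) ≤ D ∸ t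
    free-degʳ s = m+n≤o⇒m≤o∸n (count (λ c → free c s)) (begin
      count (λ c → free c s) + t                              ≤⟨ +-monoʳ-≤ (count (λ c → free c s)) (used-symbol s) ⟩
      count (λ c → free c s) + count (λ c → F c s ∧ used c s) ≡⟨ +-comm (count (λ c → free c s)) _ ⟩
      count (λ c → F c s ∧ used c s) + count (λ c → free c s) ≡⟨ count-split (λ c → F c s) (λ c → used c s) ⟨
      count (λ c → F c s)                                     ≤⟨ degʳ s ⟩
      D                                                       ∎)
      where open ≤-Reasoning

  addRow : ∀ {t} → t < D → LatinRectangle F t → LatinRectangle F (suc t)
  addRow {t} t<D L = record
    { entry            = entry′
    ; row-injective    = λ { zero → σ-injective ; (suc u) → row-injective u }
    ; column-injective = column-injective′
    ; allowed          = λ { zero c → ∧⁻ˡ (F c (σ c)) (σ-free c) ; (suc u) → allowed u }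
    }
    where
    open LatinRectangle L
    open FreeEntries L
    matching = degree-bounded-matching free (D ∸ t) (m<n⇒0<n∸m t<D) free-degˡ free-degʳ
    σ = proj₁ matching
    σ-free = proj₁ (proj₂ matching)
    σ-injective = proj₂ (proj₂ matching)
    σ-new : ∀ u c → σ c ≢ entry u c
    σ-new u c eq = not⁻ (∧⁻ʳ (F c (σ c)) (σ-free c)) (∃ᵇ⁺ u (fromWitness (sym eq)))
    entry′ : Fin (suc t) → Fin n → Fin n
    entry′ zero = σ
    entry′ (suc u) = entry u
    column-injective′ : ∀ c → Injective _≡_ _≡_ (λ u → entry′ u c)
    column-injective′ c {zero} {zero} _ = refl
    column-injective′ c {zero} {suc u'} eq = contradiction eq (σ-new u' c)
    column-injective′ c {suc u} {zero} eq = contradiction (sym eq) (σ-new u c)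
    column-injective′ c {suc u} {suc u'} eq = cong suc (column-injective c eq)

  latinRectangle : ∀ t → t ≤ D → LatinRectangle F t
  latinRectangle zero _ = record
    { entry = λ () ; row-injective = λ () ; column-injective = λ _ {u} → contradiction u Finₚ.¬Fin0 ; allowed = λ () }
  latinRectangle (suc t) t<D = addRow t<D (latinRectangle t (<⇒≤ t<D))

toℕ-combine-/ : ∀ {m n} .{{_ : NonZero n}} (i : Fin m) (j : Fin n) → toℕ (combine i j) / n ≡ toℕ i
toℕ-combine-/ {n = n} i j = begin
  toℕ (combine i j) / n           ≡⟨ cong (_/ n) (Finₚ.toℕ-combine i j) ⟩
  (n * toℕ i + toℕ j) / n         ≡⟨ +-distrib-/-∣ˡ (toℕ j) (m∣m*n (toℕ i)) ⟩
  n * toℕ i / n + toℕ j / n       ≡⟨ cong₂ _+_ (trans (cong (_/ n) (*-comm n (toℕ i))) (m*n/n≡m (toℕ i) n))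
                                                (m<n⇒m/n≡0 (Finₚ.toℕ<n j)) ⟩
  toℕ i + 0                       ≡⟨ +-identityʳ (toℕ i) ⟩
  toℕ i                           ∎
  where open ≡-Reasoning

module Sudoku (k : ℕ) where

  K N : ℕ
  K = suc k
  N = K * K

  band offset : Fin N → Fin K
  band = quotient K
  offset = remainder {K} K

  band-offset : ∀ r → combine (band r) (offset r) ≡ r
  band-offset = Finₚ.combine-remQuot {K} K

  band-combine : ∀ i j → band (combine i j) ≡ i
  band-combine i j = cong proj₁ (Finₚ.remQuot-combine i j)

  band-offset-injective : ∀ {r r'} → band r ≡ band r' → offset r ≡ offset r' → r ≡ r'
  band-offset-injective {r} {r'} b≡b' o≡o' =
    trans (sym (band-offset r)) (trans (cong₂ combine b≡b' o≡o') (band-offset r'))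

  blk≡band : ∀ r → blk K r ≡ toℕ (band r)
  blk≡band r = trans (cong (λ x → toℕ x / K) (sym (band-offset r))) (toℕ-combine-/ (band r) (offset r))

  blk≡⇒band≡ : ∀ r r' → blk K r ≡ blk K r' → band r ≡ band r'
  blk≡⇒band≡ r r' eq = Finₚ.toℕ-injective (trans (sym (blk≡band r)) (trans eq (blk≡band r')))

  band≡⇒blk≡ : ∀ r r' → band r ≡ band r' → blk K r ≡ blk K r'
  band≡⇒blk≡ r r' eq = trans (blk≡band r) (trans (cong toℕ eq) (sym (blk≡band r')))

  <*K⇒band< : ∀ {l} r → toℕ r < l * K → toℕ (band r) < l
  <*K⇒band< r lt = subst (_< _) (blk≡band r) (m<n*o⇒m/o<n lt)

  band<⇒<*K : ∀ {l} r → toℕ (band r) < l → toℕ r < l * K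
  band<⇒<*K {l} r b<l with toℕ r <? l * K
  ... | yes lt = lt
  ... | no ¬lt = contradiction b<l (≤⇒≯ (begin
    l             ≡⟨ m*n/n≡m l K ⟨
    l * K / K     ≤⟨ /-monoˡ-≤ K (≮⇒≥ ¬lt) ⟩
    toℕ r / K     ≡⟨ blk≡band r ⟩
    toℕ (band r)  ∎))
    where open ≤-Reasoning

  module ExtendBand {l} (l<K : l < K) {P : Matrix K} (rect : IsSudokuRectangle K (l * K) P) where

    private
      rowP    = proj₁ (proj₁ rect)
      colP    = proj₁ (proj₂ (proj₁ rect))
      blkP    = proj₂ (proj₂ (proj₁ rect))
      filledP = proj₁ (proj₂ rect)
      emptyP  = proj₂ (proj₂ rect)

    occurs : Fin N → Fin N → Bool
    occurs s c = ∃ᵇ λ r → ⌊ Maybeₚ.≡-dec _≟_ (P r c) (just s) ⌋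

    occurs⁺ : ∀ {r c s} → P r c ≡ just s → T (occurs s c)
    occurs⁺ {r} e = ∃ᵇ⁺ r (fromWitness e)

    occurs⁻ : ∀ {s c} → T (occurs s c) → ∃ λ r → P r c ≡ just s
    occurs⁻ o = let r , e = ∃ᵇ⁻ o in r , toWitness e

    filled⇒band< : ∀ {r c v} → P r c ≡ just v → toℕ (band r) < l
    filled⇒band< {r} {c} e with toℕ r <? l * K
    ... | yes lt = <*K⇒band< r lt
    ... | no ¬lt = contradiction (trans (sym e) (emptyP r c (≮⇒≥ ¬lt))) λ ()

    -- By the block condition, the rows carrying s in the columns of a stack lie in distinct bands.
    occurrences-in-stack : ∀ j s → count (λ x → occurs s (combine j x)) ≤ l
    occurrences-in-stack j s = subst (_ ≤_) count-⊤
      (count-injection (λ _ o → band-index o) (λ _ _ → tt) same-band⇒same-column)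
      where
      band-index : ∀ {c} → T (occurs s c) → Fin l
      band-index o = fromℕ< (filled⇒band< (proj₂ (occurs⁻ o)))
      same-band⇒same-column : ∀ x x' o o' → band-index o ≡ band-index o' → x ≡ x'
      same-band⇒same-column x x' o o' eq = Finₚ.combine-injectiveʳ j x j x'
        (proj₂ (blkP _ _ _ _ s same-block (proj₂ (occurs⁻ o)) (proj₂ (occurs⁻ o'))))
        where
        same-block : SameBlock K (proj₁ (occurs⁻ o)) (combine j x) (proj₁ (occurs⁻ o')) (combine j x')
        same-block = band≡⇒blk≡ (proj₁ (occurs⁻ o)) (proj₁ (occurs⁻ o'))
                       (Finₚ.toℕ-injective (Finₚ.fromℕ<-injective _ _ _ _ eq))
                   , band≡⇒blk≡ (combine j x) (combine j x') (trans (band-combine j x) (sym (band-combine j x')))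

    occurrences-in-column : ∀ c → l * K ≤ count (λ s → occurs s c)
    occurrences-in-column c = subst (_≤ count (λ s → occurs s c)) count-⊤
      (count-injection {p = λ _ → true} {q = λ s → occurs s c} (λ i _ → value i) (λ i _ → occurs⁺ (filled i))
        λ i i' _ _ eq → Finₚ.inject≤-injective lK≤N lK≤N i i'
          (colP (row i) (row i') c (value i) (filled i) (trans (filled i') (cong just (sym eq)))))
      where
      lK≤N : l * K ≤ N
      lK≤N = *-monoˡ-≤ K (<⇒≤ l<K)
      row : Fin (l * K) → Fin N
      row i = inject≤ i lK≤N
      row<lK : ∀ i → toℕ (row i) < l * K
      row<lK i = subst (_< l * K) (sym (Finₚ.toℕ-inject≤ i lK≤N)) (Finₚ.toℕ<n i)
      value : Fin (l * K) → Fin N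
      value i = proj₁ (filledP (row i) c (row<lK i))
      filled : ∀ i → P (row i) c ≡ just (value i)
      filled i = proj₂ (filledP (row i) c (row<lK i))

    -- Symbols are matched to the N slots of stack j, slot r lying in column band r of the stack;
    -- as each column has K slots, the matching sends exactly K symbols to each column.
    slotGraph : Fin K → Fin N → Fin N → Bool
    slotGraph j s slot = not (occurs s (combine j (band slot)))

    slot-degˡ : ∀ j s → (K ∸ l) * K ≤ count (slotGraph j s)
    slot-degˡ j s = begin
      (K ∸ l) * K                    ≡⟨ *-comm (K ∸ l) K ⟩
      K * (K ∸ l)                    ≤⟨ *-monoʳ-≤ K (∸-monoʳ-≤ K (occurrences-in-stack j s)) ⟩
      K * (K ∸ count occursʲ)        ≡⟨ cong (K *_) (count-∁ occursʲ) ⟨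
      K * count (∁ occursʲ)          ≡⟨ count-quotient K (∁ occursʲ) ⟨
      count (slotGraph j s)          ∎
      where
      open ≤-Reasoning
      occursʲ : Fin K → Bool
      occursʲ x = occurs s (combine j x)

    slot-degʳ : ∀ j slot → count (λ s → slotGraph j s slot) ≤ (K ∸ l) * K
    slot-degʳ j slot = begin
      count (∁ occursᶜ)              ≡⟨ count-∁ occursᶜ ⟩
      N ∸ count occursᶜ              ≤⟨ ∸-monoʳ-≤ N (occurrences-in-column _) ⟩
      N ∸ l * K                      ≡⟨ *-distribʳ-∸ K K l ⟨
      (K ∸ l) * K                    ∎
      where
      open ≤-Reasoning
      occursᶜ : Fin N → Bool
      occursᶜ s = occurs s (combine j (band slot))

    opaque
      slotMatching : ∀ j → Σ (Fin N → Fin N) λ σ → (∀ s → T (slotGraph j s (σ s))) × Injective _≡_ _≡_ σ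
      slotMatching j = degree-bounded-matching (slotGraph j) ((K ∸ l) * K)
        (*-mono-≤ (m<n⇒0<n∸m l<K) (s≤s z≤n)) (slot-degˡ j) (slot-degʳ j)

    target : Fin K → Fin N → Fin K
    target j s = band (proj₁ (slotMatching j) s)

    Assigned : Fin N → Fin N → Bool
    Assigned c s = ⌊ target (band c) s ≟ offset c ⌋

    assigned⁻ : ∀ {c s} → T (Assigned c s) → target (band c) s ≡ offset c
    assigned⁻ = toWitness

    assigned⇒missing : ∀ {c s} → T (Assigned c s) → ¬ T (occurs s c)
    assigned⇒missing {c} {s} a = subst (λ x → ¬ T (occurs s x)) column≡c
      (not⁻ (proj₁ (proj₂ (slotMatching (band c))) s))
      where
      column≡c : combine (band c) (target (band c) s) ≡ c
      column≡c = trans (cong (combine (band c)) (assigned⁻ {c} {s} a)) (band-offset c)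

    assigned-stack : ∀ {c c' s} → T (Assigned c s) → T (Assigned c' s) → band c ≡ band c' → c ≡ c'
    assigned-stack {c} {c'} {s} a a' b≡b' = band-offset-injective b≡b'
      (trans (sym (assigned⁻ {c} {s} a)) (trans (cong (λ j → target j s) b≡b') (assigned⁻ {c'} {s} a')))

    assigned-degˡ : ∀ c → K ≤ count (Assigned c)
    assigned-degˡ c = subst (_≤ count (Assigned c)) count-⊤
      (count-injection {p = λ _ → true} {q = Assigned c} (λ y _ → proj₁ (preimage y))
        (λ y _ → fromWitness (trans (cong band (proj₂ (preimage y))) (band-combine (offset c) y)))
        λ y y' _ _ eq → Finₚ.combine-injectiveʳ (offset c) y (offset c) y'
          (trans (sym (proj₂ (preimage y))) (trans (cong σ eq) (proj₂ (preimage y')))))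
      where
      σ = proj₁ (slotMatching (band c))
      preimage : ∀ y → ∃ λ s → σ s ≡ combine (offset c) y
      preimage y = injective⇒surjective σ (proj₂ (proj₂ (slotMatching (band c)))) (combine (offset c) y)

    assigned-degʳ : ∀ s → count (λ c → Assigned c s) ≤ K
    assigned-degʳ s = subst (count (λ c → Assigned c s) ≤_) count-⊤
      (count-injection {q = λ _ → true} (λ c _ → band c) (λ _ _ → tt) (λ _ _ a a' → assigned-stack a a'))

    opaque
      newRows : LatinRectangle Assigned K
      newRows = latinRectangle Assigned K assigned-degˡ assigned-degʳ K ≤-refl

    open LatinRectangle newRows

    newBand? : ∀ r → Dec (toℕ (band r) ≡ l)
    newBand? r = toℕ (band r) ℕₚ.≟ l

    newBand-injective : ∀ {r r'} → toℕ (band r) ≡ l → toℕ (band r') ≡ l → offset r ≡ offset r' → r ≡ r'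
    newBand-injective b b' = band-offset-injective (Finₚ.toℕ-injective (trans b (sym b')))

    Q : Matrix K
    Q r c with newBand? r
    ... | yes _ = just (entry (offset r) c)
    ... | no _  = P r c

    new≢old : ∀ u r c → P r c ≢ just (entry u c)
    new≢old u r c e = assigned⇒missing (allowed u c) (occurs⁺ e)

    Q-row : ∀ r c c' v → Q r c ≡ just v → Q r c' ≡ just v → c ≡ c'
    Q-row r c c' v e e' with newBand? r
    ... | yes _ = row-injective (offset r) (Maybeₚ.just-injective (trans e (sym e')))
    ... | no _  = rowP r c c' v e e'

    Q-col : ∀ r r' c v → Q r c ≡ just v → Q r' c ≡ just v → r ≡ r'
    Q-col r r' c v e e' with newBand? r | newBand? r'
    ... | yes b | yes b' = newBand-injective b b' (column-injective c (Maybeₚ.just-injective (trans e (sym e'))))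
    ... | yes _ | no _   = contradiction (trans e' (sym e)) (new≢old (offset r) r' c)
    ... | no _  | yes _  = contradiction (trans e (sym e')) (new≢old (offset r') r c)
    ... | no _  | no _   = colP r r' c v e e'

    Q-blk : ∀ r c r' c' v → SameBlock K r c r' c' → Q r c ≡ just v → Q r' c' ≡ just v → (r ≡ r') × (c ≡ c')
    Q-blk r c r' c' v (same-band , same-stack) e e' with newBand? r | newBand? r'
    ... | yes b | yes b' = newBand-injective b b' (column-injective c (trans v≡ (sym v≡′))) , c≡c'
      where
      v≡ : entry (offset r) c ≡ v
      v≡ = Maybeₚ.just-injective e
      c≡c' : c ≡ c'
      c≡c' = assigned-stack (subst (T ∘ Assigned c) v≡ (allowed (offset r) c))
                            (subst (T ∘ Assigned c') (Maybeₚ.just-injective e') (allowed (offset r') c'))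
                            (blk≡⇒band≡ c c' same-stack)
      v≡′ : entry (offset r') c ≡ v
      v≡′ = subst (λ x → entry (offset r') x ≡ v) (sym c≡c') (Maybeₚ.just-injective e')
    ... | yes b | no ¬b' = contradiction (trans (cong toℕ (sym (blk≡⇒band≡ r r' same-band))) b) ¬b'
    ... | no ¬b | yes b' = contradiction (trans (cong toℕ (blk≡⇒band≡ r r' same-band)) b') ¬b
    ... | no _  | no _   = blkP r c r' c' v (same-band , same-stack) e e'

    Q-filled : ∀ r c → toℕ r < suc l * K → ∃ λ v → Q r c ≡ just v
    Q-filled r c lt with newBand? r
    ... | yes _ = _ , refl
    ... | no ¬b = filledP r c (band<⇒<*K r (≤∧≢⇒< (s≤s⁻¹ (<*K⇒band< r lt)) ¬b))

    Q-empty : ∀ r c → suc l * K ≤ toℕ r → Q r c ≡ nothing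
    Q-empty r c ge with newBand? r
    ... | yes b = contradiction ge (<⇒≱ (band<⇒<*K r (s≤s (≤-reflexive b))))
    ... | no _  = emptyP r c (≤-trans (m≤n+m (l * K) K) ge)

    Q-extends : Extends K Q P
    Q-extends r c v e with newBand? r
    ... | yes b = contradiction (filled⇒band< e) (<-irrefl b)
    ... | no _  = e

  extendBand : ∀ {l} → l < K → {P : Matrix K} → IsSudokuRectangle K (l * K) P →
               Σ (Matrix K) λ Q → IsSudokuRectangle K (suc l * K) Q × Extends K Q P
  extendBand l<K rect = Q , ((Q-row , Q-col , Q-blk) , Q-filled , Q-empty) , Q-extends
    where open ExtendBand l<K rect

  completeBands : ∀ d {l} {P : Matrix K} → d + l ≡ K → IsSudokuRectangle K (l * K) P →
                  Σ (Matrix K) λ S → IsSudokuSquare K S × Extends K S P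
  completeBands zero {P = P} refl (partial , filled , _) =
    P , (partial , λ r c → filled r c (Finₚ.toℕ<n r)) , λ _ _ _ e → e
  completeBands (suc d) {l} d+l≡K rect =
    let Q , rectQ , Q⊇P = extendBand (subst (l <_) d+l≡K (m<n+m l z<s)) rect
        S , square , S⊇Q = completeBands d (trans (+-suc d l) d+l≡K) rectQ
    in S , square , λ r c v e → S⊇Q r c v (Q⊇P r c v e)

theorem1 : (k l : ℕ) → l < suc k →
    let m = l * suc k in
    (P : Matrix (suc k)) → IsSudokuRectangle (suc k) m P →
    Σ (Matrix (suc k)) λ S → IsSudokuSquare (suc k) S × Extends (suc k) S P
theorem1 k l l<K P rect = completeBands (suc k ∸ l) (m∸n+n≡m (<⇒≤ l<K)) rect
  where open Sudoku k
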